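{- Let $i\ge 0$ be an integer and let $G$ be an $\alpha_i$-metric graph. Then $\operatorname{diam}(C(G))\le 3i+2$, i.e., any two central vertices $u,v$ of $G$ satisfy $d(u,v)\le 3i+2$.
   Context: All graphs are finite, connected, unweighted, undirected, without loops or multiple edges; $d(u,v)$ is the shortest-path distance. The interval is $I(u,v)=\{x: d(u,x)+d(x,v)=d(u,v)\}$. A graph is $\alpha_i$-metric if for all vertices $u,w,v,x$: whenever $v\in I(u,w)$ and $w\in I(v,x)$ and $v,w$ are adjacent, then $d(u,x)\ge d(u,v)+d(v,x)-i$. The eccentricity is $e(v)=\max_{u}d(u,v)$, the radius $\operatorname{rad}(G)=\min_v e(v)$, and the center $C(G)=\{v: e(v)=\operatorname{rad}(G)\}$. -}

module Defs where

open import Data.Nat using (ℕ; zero; suc; _+_; _≤_; _⊔_)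
open import Data.List using (foldr; allFin)
open import Data.Fin using (Fin)
open import Data.Product using (_×_)
open import Relation.Nullary using (¬_)
open import Relation.Binary.PropositionalEquality using (_≡_)

record Graph (n : ℕ) : Set₁ where
  field
    Adj    : Fin n → Fin n → Set
    sym    : ∀ {u v} → Adj u v → Adj v u
    irrefl : ∀ {u} → ¬ Adj u u
open Graph public

data Walk {n : ℕ} (G : Graph n) : Fin n → Fin n → ℕ → Set where
  here : ∀ {u} → Walk G u u zero
  step : ∀ {u w v k} → Adj G u w → Walk G w v k → Walk G u v (suc k)

IsDist : {n : ℕ} → Graph n → Fin n → Fin n → ℕ → Set
IsDist G u v k = Walk G u v k × (∀ m → Walk G u v m → k ≤ m)

-- d is the distance function of G (its existence for all pairs = G connected).
IsDistFun : {n : ℕ} → Graph n → (Fin n → Fin n → ℕ) → Set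
IsDistFun G d = ∀ u v → IsDist G u v (d u v)

module _ {n : ℕ} (d : Fin n → Fin n → ℕ) where

  InInterval : Fin n → Fin n → Fin n → Set
  InInterval u v x = d u x + d x v ≡ d u v

  -- α_i-metric:  v ∈ I(u,w), w ∈ I(v,x), v ~ w  ⇒  d(u,x) ≥ d(u,v) + d(v,x) − i
  -- (stated without truncated subtraction: d(u,v)+d(v,x) ≤ d(u,x)+i)
  AlphaMetric : Graph n → ℕ → Set
  AlphaMetric G i = ∀ u w v x → InInterval u w v → InInterval v x w → Adj G v w
                    → d u v + d v x ≤ d u x + i

  ecc : Fin n → ℕ
  ecc v = foldr (λ u m → d u v ⊔ m) 0 (allFin n)

  Central : Fin n → Set
  Central c = ∀ y → ecc c ≤ ecc y

-- If central u, v had d(u,v) ≥ 3i+3, take c at distance i+1 from u on a u–v geodesic.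
-- Every vertex x is then strictly closer to c than to one of u, v, so e(c) < max(e(u), e(v)),
-- contradicting centrality. For if d(c,x) ≥ d(u,x), d(v,x), let z be the neighbour of c
-- towards x. The α_i-condition keeps d(·,x) = d(c,x) along the first i+1 steps of a c–v
-- geodesic, ending at p, and forces d(z,p) ∈ {i+1, i+2}. If d(z,p) = i+2 it fails on the
-- edge cz seen from p; if d(z,p) = i+1, a walk from p back to z along a z–v geodesic can never
-- drop below distance d(c,x) to x, yet d(z,x) = d(c,x) − 1.
module Submission where

open import Defs hiding (sym)
open import Data.Nat using (ℕ; zero; suc; _+_; _*_; _≤_; _<_; _⊔_; z≤n; s≤s; _≤?_)
open import Data.Nat.Properties
open import Data.Nat.Tactic.RingSolver using (solve-∀)
open import Data.Fin using (Fin)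
open import Data.List using (List; []; _∷_; foldr; allFin)
open import Data.List.Membership.Propositional using (_∈_)
open import Data.List.Membership.Propositional.Properties using (∈-allFin)
open import Data.List.Relation.Unary.Any using (here; there)
open import Data.Product using (_×_; _,_; proj₁; proj₂; ∃-syntax)
open import Data.Sum using ([_,_]′)
open import Data.Unit using (⊤; tt)
open import Data.Empty using (⊥; ⊥-elim)
open import Relation.Nullary using (¬_; yes; no)
open import Relation.Binary.PropositionalEquality
  using (_≡_; _≢_; refl; sym; trans; cong; cong₂; subst; subst₂; module ≡-Reasoning)

module Walks {n : ℕ} (G : Graph n) where

  _++ʷ_ : ∀ {a b c m k} → Walk G a b m → Walk G b c k → Walk G a c (m + k)
  here ++ʷ w′ = w′
  step e w ++ʷ w′ = step e (w ++ʷ w′)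

  _▷_ : ∀ {a b c k} → Walk G a b k → Adj G b c → Walk G a c (suc k)
  here ▷ e = step e here
  step e′ w ▷ e = step e′ (w ▷ e)

  reverse : ∀ {a b k} → Walk G a b k → Walk G b a k
  reverse here = here
  reverse (step e w) = reverse w ▷ Graph.sym G e

  adj-walk-length-pos : ∀ {a b k} → Adj G a b → Walk G a b k → 0 < k
  adj-walk-length-pos e here = ⊥-elim (irrefl G e)
  adj-walk-length-pos e (step _ _) = s≤s z≤n

module Geodesics {n : ℕ} (G : Graph n) (d : Fin n → Fin n → ℕ) (isD : IsDistFun G d) where
  open Walks G

  shortest : ∀ a b → Walk G a b (d a b)
  shortest a b = proj₁ (isD a b)

  dist-≤-walk : ∀ {a b k} → Walk G a b k → d a b ≤ k
  dist-≤-walk {a} {b} w = proj₂ (isD a b) _ w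

  dist-refl : ∀ a → d a a ≡ 0
  dist-refl a = n≤0⇒n≡0 (dist-≤-walk here)

  dist-sym : ∀ a b → d a b ≡ d b a
  dist-sym a b =
    ≤-antisym (dist-≤-walk (reverse (shortest b a))) (dist-≤-walk (reverse (shortest a b)))

  dist-triangle : ∀ a b c → d a c ≤ d a b + d b c
  dist-triangle a b c = dist-≤-walk (shortest a b ++ʷ shortest b c)

  dist-adj : ∀ {a b} → Adj G a b → d a b ≡ 1
  dist-adj {a} {b} e = ≤-antisym (dist-≤-walk (step e here)) (adj-walk-length-pos e (shortest a b))

  dist-adj-≤ : ∀ {a w b} → Adj G a w → d a b ≤ suc (d w b)
  dist-adj-≤ {w = w} {b} e = dist-≤-walk (step e (shortest w b))

  adj-<⇒≡suc : ∀ {a w b} → Adj G a w → d w b < d a b → d a b ≡ suc (d w b)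
  adj-<⇒≡suc e lt = ≤-antisym (dist-adj-≤ e) lt

  private
    first-step : ∀ {a b k} → Walk G a b k → k ≡ d a b → 0 < d a b
               → ∃[ w ] (Adj G a w × d a b ≡ suc (d w b))
    first-step here eq pos = ⊥-elim (<-irrefl eq pos)
    first-step {b = b} (step {w = w} e walk) eq _ =
      w , e , ≤-antisym (dist-adj-≤ e) (subst (suc (d w b) ≤_) eq (s≤s (dist-≤-walk walk)))

  step-toward : ∀ {a b} → 0 < d a b → ∃[ w ] (Adj G a w × d a b ≡ suc (d w b))
  step-toward {a} {b} = first-step (shortest a b) refl

  step-along : ∀ {a b x x′} → InInterval d a b x → Adj G x x′ → d x b ≡ suc (d x′ b)
             → d a x′ ≡ suc (d a x) × InInterval d a b x′
  step-along {a} {b} {x} {x′} axb e xb = ax′ , (begin-equality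
      d a x′ + d x′ b        ≡⟨ cong (_+ d x′ b) ax′ ⟩
      suc (d a x + d x′ b)   ≡⟨ sym (+-suc (d a x) (d x′ b)) ⟩
      d a x + suc (d x′ b)   ≡⟨ cong (d a x +_) (sym xb) ⟩
      d a x + d x b          ≡⟨ axb ⟩
      d a b                  ∎)
    where
    open ≤-Reasoning
    ax′ : d a x′ ≡ suc (d a x)
    ax′ = ≤-antisym
      (begin
        d a x′         ≤⟨ dist-triangle a x x′ ⟩
        d a x + d x x′ ≡⟨ cong (d a x +_) (dist-adj e) ⟩
        d a x + 1      ≡⟨ +-comm (d a x) 1 ⟩
        suc (d a x)    ∎)
      (+-cancelʳ-≤ (d x′ b) (suc (d a x)) (d a x′) (begin
        suc (d a x) + d x′ b  ≡⟨ sym (+-suc (d a x) (d x′ b)) ⟩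
        d a x + suc (d x′ b)  ≡⟨ cong (d a x +_) (sym xb) ⟩
        d a x + d x b         ≡⟨ axb ⟩
        d a b                 ≤⟨ dist-triangle a x′ b ⟩
        d a x′ + d x′ b       ∎))

  interval-cons : ∀ {y y′ b p} → Adj G y y′ → d y b ≡ suc (d y′ b) → InInterval d y′ b p
                → d y p ≡ suc (d y′ p) × InInterval d y b p
  interval-cons {y} {y′} {b} {p} e yb y′pb = yp , (begin-equality
      d y p + d p b          ≡⟨ cong (_+ d p b) yp ⟩
      suc (d y′ p + d p b)   ≡⟨ cong suc y′pb ⟩
      suc (d y′ b)           ≡⟨ sym yb ⟩
      d y b                  ∎)
    where
    open ≤-Reasoning
    yp : d y p ≡ suc (d y′ p)
    yp = ≤-antisym (dist-adj-≤ e) (+-cancelʳ-≤ (d p b) (suc (d y′ p)) (d y p) (begin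
      suc (d y′ p + d p b)   ≡⟨ cong suc y′pb ⟩
      suc (d y′ b)           ≡⟨ sym yb ⟩
      d y b                  ≤⟨ dist-triangle y p b ⟩
      d y p + d p b          ∎))

  walk-toward : (P : Fin n → Set) {b : Fin n} {ℓ : ℕ}
    → (∀ {q q′} → Adj G q q′ → d q b ≡ suc (d q′ b) → ℓ ≤ d q′ b → P q → P q′)
    → ∀ k {y} → ℓ + k ≤ d y b → P y → ∃[ p ] (d y p ≡ k × InInterval d y b p × P p)
  walk-toward P {b} preserved zero {y} _ Py = y , dist-refl y , cong (_+ d y b) (dist-refl y) , Py
  walk-toward P {b} {ℓ} preserved (suc k) {y} bound Py = extend (step-toward 0<yb)
    where
    0<yb : 0 < d y b
    0<yb = <-≤-trans (s≤s z≤n) (≤-trans (m≤n+m (suc k) ℓ) bound)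
    extend : ∃[ y′ ] (Adj G y y′ × d y b ≡ suc (d y′ b))
           → ∃[ p ] (d y p ≡ suc k × InInterval d y b p × P p)
    extend (y′ , e , yb) = prepend (walk-toward P preserved k bound′ (preserved e yb ℓ≤y′b Py))
      where
      bound′ : ℓ + k ≤ d y′ b
      bound′ = ≤-pred (subst₂ _≤_ (+-suc ℓ k) yb bound)
      ℓ≤y′b : ℓ ≤ d y′ b
      ℓ≤y′b = ≤-trans (m≤m+n ℓ k) bound′
      prepend : ∃[ p ] (d y′ p ≡ k × InInterval d y′ b p × P p)
              → ∃[ p ] (d y p ≡ suc k × InInterval d y b p × P p)
      prepend (p , y′p , y′pb , Pp) =
        p , trans (proj₁ (interval-cons e yb y′pb)) (cong suc y′p) , proj₂ (interval-cons e yb y′pb) , Pp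

  geodesic-point : ∀ a b {s} → s ≤ d a b → ∃[ c ] (d a c ≡ s × InInterval d a b c)
  geodesic-point a b {s} s≤ab with walk-toward (λ _ → ⊤) {ℓ = 0} (λ _ _ _ _ → tt) s s≤ab tt
  ... | c , ac , acb , _ = c , ac , acb

module Eccentricity {n : ℕ} (d : Fin n → Fin n → ℕ) where

  private
    farthest : Fin n → List (Fin n) → ℕ
    farthest c = foldr (λ u m → d u c ⊔ m) 0

    ≤-farthest : ∀ {y c xs} → y ∈ xs → d y c ≤ farthest c xs
    ≤-farthest (here refl) = m≤m⊔n _ _
    ≤-farthest {c = c} {x ∷ _} (there y∈xs) = ≤-trans (≤-farthest y∈xs) (m≤n⊔m (d x c) _)

    farthest-< : ∀ {c B} → 0 < B → (∀ y → d y c < B) → ∀ xs → farthest c xs < B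
    farthest-< 0<B _ [] = 0<B
    farthest-< 0<B h (x ∷ xs) = ⊔-lub (h x) (farthest-< 0<B h xs)

  dist-≤-ecc : ∀ y c → d y c ≤ ecc d c
  dist-≤-ecc y c = ≤-farthest (∈-allFin y)

  ecc-< : ∀ {c B} → (∀ y → d y c < B) → ecc d c < B
  ecc-< {c} h = farthest-< (≤-<-trans z≤n (h c)) h (allFin n)

  ¬both-central : ∀ {u v c} → (∀ x → d x c < d x u ⊔ d x v) → Central d u → Central d v → ⊥
  ¬both-central {u} {v} {c} closer cu cv = <⇒≱ (ecc-< farther-from-c) (⊔-lub (cu c) (cv c))
    where
    farther-from-c : ∀ x → d x c < ecc d u ⊔ ecc d v
    farther-from-c x = <-≤-trans (closer x) (⊔-mono-≤ (dist-≤-ecc x u) (dist-≤-ecc x v))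

module AlphaGeodesics {n : ℕ} (G : Graph n) (d : Fin n → Fin n → ℕ) (isD : IsDistFun G d)
                      (i : ℕ) (α : AlphaMetric d G i) where
  open Geodesics G d isD

  alpha-step : ∀ {b p q x} → Adj G p q → d b q ≡ suc (d b p) → d p x ≡ suc (d q x)
             → d b x ≤ d p x → d b p ≤ i
  alpha-step {b} {p} {q} {x} e bq px bx = +-cancelʳ-≤ (d p x) (d b p) i (begin
      d b p + d p x  ≤⟨ α b q p x bpq pqx e ⟩
      d b x + i      ≤⟨ +-monoˡ-≤ i bx ⟩
      d p x + i      ≡⟨ +-comm (d p x) i ⟩
      i + d p x      ∎)
    where
    open ≤-Reasoning
    bpq : InInterval d b q p
    bpq = trans (cong (d b p +_) (dist-adj e)) (trans (+-comm (d b p) 1) (sym bq))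
    pqx : InInterval d p x q
    pqx = trans (cong (_+ d q x) (dist-adj e)) (sym px)

  no-descent : ∀ {b q q′ x M} → Adj G q q′ → d b q′ ≡ suc (d b q) → i < d b q
             → d b x ≤ M → M ≤ d q x → M ≤ d q′ x
  no-descent {b} {q} {q′} {x} {M} e bq′ i<bq bx M≤qx with M ≤? d q′ x
  ... | yes M≤q′x = M≤q′x
  ... | no M≰q′x = ⊥-elim (<⇒≱ i<bq (alpha-step e bq′ qx (≤-trans bx M≤qx)))
    where
    qx : d q x ≡ suc (d q′ x)
    qx = adj-<⇒≡suc e (<-≤-trans (≰⇒> M≰q′x) M≤qx)

  level-step : ∀ {u v q q′ x M} → Adj G q q′
    → d u q′ ≡ suc (d u q) → d v q ≡ suc (d v q′) → i < d u q → i < d v q′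
    → d u x ≤ M → d v x ≤ M → d q x ≡ M → d q′ x ≡ M
  level-step {q = q} {q′} {x} {M} e uq′ vq i<uq i<vq′ ux vx qx =
    ≤-antisym (≮⇒≥ above) (no-descent e uq′ i<uq ux (≤-reflexive (sym qx)))
    where
    above : ¬ M < d q′ x
    above M<q′x =
      1+n≰n (subst (suc M ≤_) qx (no-descent (Graph.sym G e) vq i<vq′ (m≤n⇒m≤1+n vx) M<q′x))

  parallel-step : ∀ {u v c z x} → InInterval d u v c → i < d u c → i < d c v
    → d u x ≤ d c x → d v x ≤ d c x → Adj G c z → d c x ≡ suc (d z x) → d z v ≡ d c v
  parallel-step {u} {v} {c} {z} ucv i<uc i<cv ux vx e cx = ≤-antisym (≮⇒≥ farther) (≮⇒≥ closer)
    where
    farther : ¬ d c v < d z v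
    farther cv<zv = <⇒≱ i<cv (subst (_≤ i) (dist-sym v c) (alpha-step e vz cx vx))
      where
      vz : d v z ≡ suc (d v c)
      vz = trans (dist-sym v z)
             (trans (adj-<⇒≡suc (Graph.sym G e) cv<zv) (cong suc (dist-sym c v)))
    closer : ¬ d z v < d c v
    closer zv<cv =
      <⇒≱ i<uc (alpha-step e (proj₁ (step-along ucv e (adj-<⇒≡suc e zv<cv))) cx ux)

  module _ {u v c : Fin n} (ucv : InInterval d u v c) (uc : d u c ≡ suc i)
           (cv : suc i + suc i ≤ d c v) where

    private
      i<uc : i < d u c
      i<uc = ≤-reflexive (sym uc)

      i<cv : i < d c v
      i<cv = ≤-trans (m≤m+n (suc i) (suc i)) cv

      module FarPoint {x : Fin n} (ux : d u x ≤ d c x) (vx : d v x ≤ d c x) where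

        0<cx : 0 < d c x
        0<cx = n≢0⇒n>0 λ cx≡0 → n≮0 (begin
          suc i          ≡⟨ sym uc ⟩
          d u c          ≤⟨ dist-triangle u x c ⟩
          d u x + d x c  ≤⟨ +-mono-≤ ux (≤-reflexive (dist-sym x c)) ⟩
          d c x + d c x  ≡⟨ cong₂ _+_ cx≡0 cx≡0 ⟩
          0              ∎)
          where open ≤-Reasoning

        z : Fin n
        z = proj₁ (step-toward 0<cx)

        cz : Adj G c z
        cz = proj₁ (proj₂ (step-toward 0<cx))

        cx≡1+zx : d c x ≡ suc (d z x)
        cx≡1+zx = proj₂ (proj₂ (step-toward 0<cx))

        zv≡cv : d z v ≡ d c v
        zv≡cv = parallel-step ucv i<uc i<cv ux vx cz cx≡1+zx

        OnLevel : Fin n → Set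
        OnLevel q = InInterval d u v q × i < d u q × d q x ≡ d c x

        on-level-step : ∀ {q q′} → Adj G q q′ → d q v ≡ suc (d q′ v) → suc i ≤ d q′ v
                      → OnLevel q → OnLevel q′
        on-level-step {q} {q′} e qv i<q′v (uqv , i<uq , qx) =
          uq′v , subst (i <_) (sym uq′) (m<n⇒m<1+n i<uq) , level-step e uq′ vq i<uq i<vq′ ux vx qx
          where
          uq′ : d u q′ ≡ suc (d u q)
          uq′ = proj₁ (step-along uqv e qv)
          uq′v : InInterval d u v q′
          uq′v = proj₂ (step-along uqv e qv)
          vq : d v q ≡ suc (d v q′)
          vq = trans (dist-sym v q) (trans qv (cong suc (dist-sym q′ v)))
          i<vq′ : i < d v q′
          i<vq′ = subst (i <_) (dist-sym q′ v) i<q′v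

        level-walk : ∃[ p ] (d c p ≡ suc i × InInterval d c v p × OnLevel p)
        level-walk = walk-toward OnLevel on-level-step (suc i) cv (ucv , i<uc , refl)

        p : Fin n
        p = proj₁ level-walk

        cp≡1+i : d c p ≡ suc i
        cp≡1+i = proj₁ (proj₂ level-walk)

        cpv : InInterval d c v p
        cpv = proj₁ (proj₂ (proj₂ level-walk))

        px≡cx : d p x ≡ d c x
        px≡cx = proj₂ (proj₂ (proj₂ (proj₂ (proj₂ level-walk))))

        cv≡1+i+pv : d c v ≡ suc i + d p v
        cv≡1+i+pv = trans (sym cpv) (cong (_+ d p v) cp≡1+i)

        i<pv : i < d p v
        i<pv = +-cancelˡ-≤ (suc i) (suc i) (d p v) (subst (suc i + suc i ≤_) cv≡1+i+pv cv)

        1+i≤zp : suc i ≤ d z p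
        1+i≤zp = +-cancelʳ-≤ (d p v) (suc i) (d z p) (begin
          suc i + d p v  ≡⟨ sym cv≡1+i+pv ⟩
          d c v          ≡⟨ sym zv≡cv ⟩
          d z v          ≤⟨ dist-triangle z p v ⟩
          d z p + d p v  ∎)
          where open ≤-Reasoning

        zp≤2+i : d z p ≤ suc (suc i)
        zp≤2+i = subst (λ t → d z p ≤ suc t) cp≡1+i (dist-adj-≤ (Graph.sym G cz))

        -- Here c ∈ I(z,p) and z ∈ I(c,x) while p is on the level of c.
        zp≢2+i : d z p ≢ suc (suc i)
        zp≢2+i zp = 1+n≰n (subst (_≤ i) pc≡1+i (alpha-step cz pz cx≡1+zx (≤-reflexive px≡cx)))
          where
          pc≡1+i : d p c ≡ suc i
          pc≡1+i = trans (dist-sym p c) cp≡1+i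
          pz : d p z ≡ suc (d p c)
          pz = trans (dist-sym p z) (trans zp (cong suc (sym pc≡1+i)))

        AboveLevel : Fin n → Set
        AboveLevel q = InInterval d v z q × i < d v q × d c x ≤ d q x

        above-level-step : ∀ {q q′} → Adj G q q′ → d q z ≡ suc (d q′ z) → 0 ≤ d q′ z
                         → AboveLevel q → AboveLevel q′
        above-level-step {q} {q′} e qz _ (vqz , i<vq , cx≤qx) =
          proj₂ (step-along vqz e qz) ,
          subst (i <_) (sym vq′) (m<n⇒m<1+n i<vq) ,
          no-descent e vq′ i<vq vx cx≤qx
          where
          vq′ : d v q′ ≡ suc (d v q)
          vq′ = proj₁ (step-along vqz e qz)

        -- Here p ∈ I(z,v), so walking back from p to z only moves away from v.
        zp≢1+i : d z p ≢ suc i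
        zp≢1+i zp = reaches-z (walk-toward AboveLevel {ℓ = 0} above-level-step (d p z) ≤-refl
                                 (vpz , subst (i <_) (dist-sym p v) i<pv , ≤-reflexive (sym px≡cx)))
          where
          vpz : InInterval d v z p
          vpz = begin
            d v p + d p z  ≡⟨ cong₂ _+_ (dist-sym v p) (trans (dist-sym p z) zp) ⟩
            d p v + suc i  ≡⟨ +-comm (d p v) (suc i) ⟩
            suc i + d p v  ≡⟨ sym cv≡1+i+pv ⟩
            d c v          ≡⟨ sym zv≡cv ⟩
            d z v          ≡⟨ dist-sym z v ⟩
            d v z          ∎
            where open ≡-Reasoning
          reaches-z : ∃[ p′ ] (d p p′ ≡ d p z × InInterval d p z p′ × AboveLevel p′) → ⊥
          reaches-z (p′ , pp′ , pp′z , (_ , _ , cx≤p′x)) = 1+n≰n (begin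
            suc (d z x)    ≡⟨ sym cx≡1+zx ⟩
            d c x          ≤⟨ cx≤p′x ⟩
            d p′ x         ≤⟨ dist-triangle p′ z x ⟩
            d p′ z + d z x ≡⟨ cong (_+ d z x) p′z≡0 ⟩
            d z x          ∎)
            where
            open ≤-Reasoning
            p′z≡0 : d p′ z ≡ 0
            p′z≡0 = +-cancelˡ-≡ (d p z) (d p′ z) 0
                      (trans (cong (_+ d p′ z) (sym pp′)) (trans pp′z (sym (+-identityʳ (d p z)))))

        absurd : ⊥
        absurd = [ (λ 1+i<zp → zp≢2+i (≤-antisym zp≤2+i 1+i<zp)) , (λ 1+i≡zp → zp≢1+i (sym 1+i≡zp)) ]′
                   (m≤n⇒m<n∨m≡n 1+i≤zp)

    centre-closer : ∀ x → d x c < d x u ⊔ d x v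
    centre-closer x = ≰⇒> λ far → FarPoint.absurd {x} (flip (m≤m⊔n (d x u) (d x v)) far)
                                                  (flip (m≤n⊔m (d x u) (d x v)) far)
      where
      flip : ∀ {a m} → d x a ≤ m → m ≤ d x c → d a x ≤ d c x
      flip xa≤m m≤xc = subst₂ _≤_ (dist-sym x _) (dist-sym x c) (≤-trans xa≤m m≤xc)

private
  3+3i≡[1+i]+[[1+i]+[1+i]] : ∀ i → suc (3 * i + 2) ≡ suc i + (suc i + suc i)
  3+3i≡[1+i]+[[1+i]+[1+i]] = solve-∀

theorem1 : ∀ {n : ℕ} (G : Graph n) (d : Fin n → Fin n → ℕ) (i : ℕ)
           → IsDistFun G d → AlphaMetric d G i
           → ∀ u v → Central d u → Central d v → d u v ≤ 3 * i + 2
theorem1 G d i isD α u v cu cv = ≮⇒≥ λ far →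
  let 3i+3≤uv = subst (_≤ d u v) (3+3i≡[1+i]+[[1+i]+[1+i]] i) far
      (c , uc , ucv) = geodesic-point u v (≤-trans (m≤m+n (suc i) _) 3i+3≤uv)
      2i+2≤cv = +-cancelˡ-≤ (suc i) _ _
                  (subst (_ ≤_) (trans (sym ucv) (cong (_+ d c v) uc)) 3i+3≤uv)
  in ¬both-central (centre-closer ucv uc 2i+2≤cv) cu cv
  where
  open Geodesics G d isD
  open AlphaGeodesics G d isD i α
  open Eccentricity d
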